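{- For all integers $0\le t\le j$, \[ L(j,t)=\frac{1}{\Lambda-1}\left(a_{j+1}+\left(\Lambda_{j-t}-1\right)a_t-\sum_{i=1}^{j-t}\lambda_ia_{j+1-i}\right). \]
   Context: Fix nonnegative integers $\lambda_1,\lambda_2,\dots$ and an integer $k\ge1$ (the order) such that $\lambda_1\ge1$, $\lambda_k\ge1$, $\lambda_i=0$ for $i>k$, and $\lambda_1\ge2$ if $k=1$. Define $(a_n)_{n\in\mathbb Z}$ by $a_n=1$ for $n\le0$ and $a_n=\sum_{i=1}^k\lambda_ia_{n-i}$ for $n\ge1$. Let $\Lambda_j=\sum_{i=1}^j\lambda_i$ (so $\Lambda_0=0$) and $\Lambda=\Lambda_k$. Finite ordered trees $T_j$: $T_0$ is a single node; for $j\ge1$, $T_j$ has a chain of special nodes $s_j$ (root), $s_{j-1},\dots,s_0$ with $s_i$ on level $i$ and $s_{i-1}$ the leftmost child of $s_i$, and $s_i$ ($1\le i\le j$) has $\Lambda_{j-i+1}$ children: $s_{i-1}$ followed by $\Lambda_{j-i+1}-1$ roots of copies of $T_{i-1}$. For $0\le t\le j$, $L(j,t)$ denotes the number of leaves of $T_j$ that descend from (or equal) its special node $s_t$ on level $t$. -}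

module Defs where

open import Data.Nat using (ℕ; zero; suc; _+_; _*_; _∸_)
open import Data.List using (List; []; _∷_; replicate)

-- A coefficient sequence λ : ℕ → ℕ, where  λ i  is λ_i for i ≥ 1
-- (the value at 0 is never used).

Σ₁ : ℕ → (ℕ → ℕ) → ℕ
Σ₁ zero    f = 0
Σ₁ (suc n) f = Σ₁ n f + f (suc n)

Λ : (ℕ → ℕ) → ℕ → ℕ
Λ lam j = Σ₁ j lam

nth1 : ℕ → List ℕ → ℕ
nth1 _       []       = 1
nth1 zero    (x ∷ _)  = x
nth1 (suc n) (_ ∷ xs) = nth1 n xs

-- as lam k n = [a_n, a_{n-1}, ..., a_0]; entries beyond the end are a_m = 1 for m ≤ 0.
as : (ℕ → ℕ) → ℕ → ℕ → List ℕ
as lam k zero    = 1 ∷ []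
as lam k (suc n) = Σ₁ k (λ i → lam i * nth1 (i ∸ 1) (as lam k n)) ∷ as lam k n

a : (ℕ → ℕ) → ℕ → ℕ → ℕ
a lam k n = nth1 0 (as lam k n)

data Tree : Set where
  node : List Tree → Tree

mutual
  leaves : Tree → ℕ
  leaves (node []) = 1
  leaves (node (c ∷ cs)) = leaves c + leavesL cs

  leavesL : List Tree → ℕ
  leavesL [] = 0
  leavesL (c ∷ cs) = leaves c + leavesL cs

mutual
  -- Sub j i : the subtree of T_j rooted at the special node s_i (i ≤ j).
  -- s_0 is a leaf; s_i (i ≥ 1) has children s_{i-1} followed by
  -- Λ_{j-i+1} - 1 copies of T_{i-1}.
  Sub : (ℕ → ℕ) → ℕ → ℕ → Tree
  Sub lam j zero    = node []
  Sub lam j (suc i) = node (Sub lam j i ∷ replicate (Λ lam (suc (j ∸ suc i)) ∸ 1) (T lam i))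

  T : (ℕ → ℕ) → ℕ → Tree
  T lam j = Sub lam j j

leftmost : Tree → Tree
leftmost (node [])      = node []
leftmost (node (c ∷ _)) = c

iter : ℕ → (Tree → Tree) → Tree → Tree
iter zero    f x = x
iter (suc n) f x = f (iter n f x)

special : (ℕ → ℕ) → ℕ → ℕ → Tree
special lam j t = iter (j ∸ t) leftmost (T lam j)

L : (ℕ → ℕ) → ℕ → ℕ → ℕ
L lam j t = leaves (special lam j t)

-- Writing R(j,t) for the right-hand side, both (Λ - 1) L(j,t) and R(j,t)
-- obey the recurrence X(j,t+1) = X(j,t) + (Λ_{j-t} - 1) X(t,t).  For the tree
-- this is the unfolding of s_{t+1}; for R it holds because R(t,t) = a_{t+1} - a_t.
-- The initial values agree, R(j,0) = Λ - 1: in a_{j+1} = Σ_{i ≤ k} λ_i a_{j+1-i}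
-- the terms with i > j have a_{j+1-i} = 1 and contribute Λ - Λ_j.
module Submission where

open import Defs
import Data.Nat as ℕ
open import Data.Nat using (ℕ; _≤_; _>_; _∸_; suc)
open import Data.Integer using (ℤ; +_; _+_; _-_; _*_)
open import Relation.Binary.PropositionalEquality using (_≡_)

open import Data.Nat using (zero; z≤n; s≤s)
import Data.Nat.Properties as ℕP
import Data.Integer.Properties as ℤP
open import Data.Integer.Tactic.RingSolver using (solve-∀)
open import Data.List using (replicate)
open import Relation.Binary.PropositionalEquality
  using (refl; sym; trans; cong; cong₂; module ≡-Reasoning)

∸≡suc[∸suc] : ∀ {m n} → suc n ≤ m → m ∸ n ≡ suc (m ∸ suc n)
∸≡suc[∸suc] {suc m} {zero}  _         = refl
∸≡suc[∸suc] {suc m} {suc n} (s≤s n<m) = ∸≡suc[∸suc] n<m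

pos-∸1 : ∀ {n} → 1 ≤ n → + (n ∸ 1) ≡ + n - + 1
pos-∸1 {suc n} _ = refl

Σ₁-cong : ∀ n {f g : ℕ → ℕ} → (∀ i → f (suc i) ≡ g (suc i)) → Σ₁ n f ≡ Σ₁ n g
Σ₁-cong zero    f≗g = refl
Σ₁-cong (suc n) f≗g = cong₂ ℕ._+_ (Σ₁-cong n f≗g) (f≗g n)

Σ₁-beyond-support : ∀ k d {f : ℕ → ℕ} → (∀ i → i > k → f i ≡ 0) →
                    Σ₁ (d ℕ.+ k) f ≡ Σ₁ k f
Σ₁-beyond-support k zero    f≡0 = refl
Σ₁-beyond-support k (suc d) f≡0 = begin
  Σ₁ (d ℕ.+ k) _ ℕ.+ _ ≡⟨ cong₂ ℕ._+_ (Σ₁-beyond-support k d f≡0) (f≡0 _ (s≤s (ℕP.m≤n+m k d))) ⟩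
  Σ₁ k _ ℕ.+ 0         ≡⟨ ℕP.+-identityʳ _ ⟩
  Σ₁ k _               ∎
  where open ≡-Reasoning

Σ₁-exchange-tail : ∀ n d {f g : ℕ → ℕ} → (∀ i → i > n → f i ≡ g i) →
                   Σ₁ (d ℕ.+ n) f ℕ.+ Σ₁ n g ≡ Σ₁ n f ℕ.+ Σ₁ (d ℕ.+ n) g
Σ₁-exchange-tail n zero    f≡g = refl
Σ₁-exchange-tail n (suc d) {f} {g} f≡g = begin
  (Σ₁ (d ℕ.+ n) f ℕ.+ f i) ℕ.+ Σ₁ n g ≡⟨ ℕP.+-assoc (Σ₁ (d ℕ.+ n) f) (f i) _ ⟩
  Σ₁ (d ℕ.+ n) f ℕ.+ (f i ℕ.+ Σ₁ n g) ≡⟨ cong (Σ₁ (d ℕ.+ n) f ℕ.+_) (ℕP.+-comm (f i) _) ⟩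
  Σ₁ (d ℕ.+ n) f ℕ.+ (Σ₁ n g ℕ.+ f i) ≡⟨ sym (ℕP.+-assoc (Σ₁ (d ℕ.+ n) f) _ (f i)) ⟩
  (Σ₁ (d ℕ.+ n) f ℕ.+ Σ₁ n g) ℕ.+ f i ≡⟨ cong₂ ℕ._+_ (Σ₁-exchange-tail n d f≡g) (f≡g i (s≤s (ℕP.m≤n+m n d))) ⟩
  (Σ₁ n f ℕ.+ Σ₁ (d ℕ.+ n) g) ℕ.+ g i ≡⟨ ℕP.+-assoc (Σ₁ n f) _ (g i) ⟩
  Σ₁ n f ℕ.+ Σ₁ (suc d ℕ.+ n) g       ∎
  where
  open ≡-Reasoning
  i = suc (d ℕ.+ n)

Λ-pos : ∀ lam {n} → 1 ≤ n → 1 ≤ lam 1 → 1 ≤ Λ lam n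
Λ-pos lam {suc zero}    _ λ₁-pos = λ₁-pos
Λ-pos lam {suc (suc n)} _ λ₁-pos =
  ℕP.≤-trans (Λ-pos lam (s≤s z≤n) λ₁-pos) (ℕP.m≤m+n (Λ lam (suc n)) _)

leavesL-replicate : ∀ n x → leavesL (replicate n x) ≡ n ℕ.* leaves x
leavesL-replicate zero    x = refl
leavesL-replicate (suc n) x = cong (leaves x ℕ.+_) (leavesL-replicate n x)

iter-suc′ : ∀ n (f : Tree → Tree) x → iter (suc n) f x ≡ iter n f (f x)
iter-suc′ zero    f x = refl
iter-suc′ (suc n) f x = cong f (iter-suc′ n f x)

module _ (lam : ℕ → ℕ) where

  iter-leftmost-Sub : ∀ j n t → iter n leftmost (Sub lam j (n ℕ.+ t)) ≡ Sub lam j t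
  iter-leftmost-Sub j zero    t = refl
  iter-leftmost-Sub j (suc n) t = trans (iter-suc′ n leftmost _) (iter-leftmost-Sub j n t)

  special≡Sub : ∀ {j t} → t ≤ j → special lam j t ≡ Sub lam j t
  special≡Sub {j} {t} t≤j = trans
    (cong (λ m → iter (j ∸ t) leftmost (Sub lam j m)) (sym (ℕP.m∸n+n≡m t≤j)))
    (iter-leftmost-Sub j (j ∸ t) t)

  leaves-Sub-suc : 1 ≤ lam 1 → ∀ {j t} → suc t ≤ j →
    + leaves (Sub lam j (suc t))
      ≡ + leaves (Sub lam j t) + (+ Λ lam (j ∸ t) - + 1) * + leaves (T lam t)
  leaves-Sub-suc λ₁-pos {j} {t} t<j = begin
    + (leaves (Sub lam j t) ℕ.+ leavesL (replicate (Λ lam (suc u) ∸ 1) (T lam t)))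
      ≡⟨ cong (λ n → + (leaves (Sub lam j t) ℕ.+ n)) (leavesL-replicate (Λ lam (suc u) ∸ 1) (T lam t)) ⟩
    + (leaves (Sub lam j t) ℕ.+ (Λ lam (suc u) ∸ 1) ℕ.* leaves (T lam t))
      ≡⟨ trans (ℤP.pos-+ (leaves (Sub lam j t)) _)
               (cong (_+_ (+ leaves (Sub lam j t))) (ℤP.pos-* (Λ lam (suc u) ∸ 1) _)) ⟩
    + leaves (Sub lam j t) + + (Λ lam (suc u) ∸ 1) * + leaves (T lam t)
      ≡⟨ cong (λ x → + leaves (Sub lam j t) + x * + leaves (T lam t))
              (trans (pos-∸1 (Λ-pos lam {suc u} (s≤s z≤n) λ₁-pos))
                     (cong (λ m → + Λ lam m - + 1) (sym (∸≡suc[∸suc] t<j)))) ⟩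
    + leaves (Sub lam j t) + (+ Λ lam (j ∸ t) - + 1) * + leaves (T lam t)
      ∎
    where
    open ≡-Reasoning
    u = j ∸ suc t

module _ (lam : ℕ → ℕ) (k : ℕ) where

  nth1-as : ∀ m n → nth1 m (as lam k n) ≡ a lam k (n ∸ m)
  nth1-as zero    zero    = refl
  nth1-as (suc m) zero    = refl
  nth1-as zero    (suc n) = refl
  nth1-as (suc m) (suc n) = nth1-as m n

  recurrenceSum : ℕ → ℕ → ℕ
  recurrenceSum j m = Σ₁ m (λ i → lam i ℕ.* a lam k (suc j ∸ i))

  a-suc : ∀ j → a lam k (suc j) ≡ recurrenceSum j k
  a-suc j = Σ₁-cong k (λ i → cong (lam (suc i) ℕ.*_) (nth1-as i j))

  a-suc+Λ : (∀ i → i > k → lam i ≡ 0) → ∀ j →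
            a lam k (suc j) ℕ.+ Λ lam j ≡ recurrenceSum j j ℕ.+ Λ lam k
  a-suc+Λ support j = begin
    a lam k (suc j) ℕ.+ Λ lam j
      ≡⟨ cong (ℕ._+ Λ lam j) (a-suc j) ⟩
    recurrenceSum j k ℕ.+ Λ lam j
      ≡⟨ cong (ℕ._+ Λ lam j) (sym (Σ₁-beyond-support k j summand-support)) ⟩
    recurrenceSum j (j ℕ.+ k) ℕ.+ Λ lam j
      ≡⟨ cong (λ m → recurrenceSum j m ℕ.+ Λ lam j) (ℕP.+-comm j k) ⟩
    recurrenceSum j (k ℕ.+ j) ℕ.+ Λ lam j
      ≡⟨ Σ₁-exchange-tail j k summand-beyond-j ⟩
    recurrenceSum j j ℕ.+ Λ lam (k ℕ.+ j)
      ≡⟨ cong (λ m → recurrenceSum j j ℕ.+ Λ lam m) (ℕP.+-comm k j) ⟩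
    recurrenceSum j j ℕ.+ Λ lam (j ℕ.+ k)
      ≡⟨ cong (recurrenceSum j j ℕ.+_) (Σ₁-beyond-support k j support) ⟩
    recurrenceSum j j ℕ.+ Λ lam k
      ∎
    where
    open ≡-Reasoning
    summand-support : ∀ i → i > k → lam i ℕ.* a lam k (suc j ∸ i) ≡ 0
    summand-support i i>k = cong (ℕ._* a lam k (suc j ∸ i)) (support i i>k)
    summand-beyond-j : ∀ i → i > j → lam i ℕ.* a lam k (suc j ∸ i) ≡ lam i
    summand-beyond-j i i>j =
      trans (cong (λ m → lam i ℕ.* a lam k m) (ℕP.m≤n⇒m∸n≡0 i>j)) (ℕP.*-identityʳ (lam i))

  closedForm : ℕ → ℕ → ℤ
  closedForm j t =
    + a lam k (suc j) + (+ Λ lam (j ∸ t) - + 1) * + a lam k t - + recurrenceSum j (j ∸ t)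

  closedForm-zero : 1 ≤ Λ lam k → (∀ i → i > k → lam i ≡ 0) → ∀ j →
                    closedForm j 0 ≡ + (Λ lam k ∸ 1)
  closedForm-zero Λ-pos support j = trans
    (rearrange (+ a lam k (suc j)) (+ Λ lam j) (+ recurrenceSum j j) (+ Λ lam k)
      (trans (sym (ℤP.pos-+ (a lam k (suc j)) _))
             (trans (cong +_ (a-suc+Λ support j)) (ℤP.pos-+ (recurrenceSum j j) _))))
    (sym (pos-∸1 Λ-pos))
    where
    rearrange : ∀ A L S K → A + L ≡ S + K → A + (L - + 1) * + 1 - S ≡ K - + 1
    rearrange A L S K A+L≡S+K = begin
      A + (L - + 1) * + 1 - S ≡⟨ move-1 A L S ⟩
      A + L - S - + 1         ≡⟨ cong (λ x → x - S - + 1) A+L≡S+K ⟩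
      S + K - S - + 1         ≡⟨ cancel S K ⟩
      K - + 1                 ∎
      where
      open ≡-Reasoning
      move-1 : ∀ A L S → A + (L - + 1) * + 1 - S ≡ A + L - S - + 1
      move-1 = solve-∀
      cancel : ∀ S K → S + K - S - + 1 ≡ K - + 1
      cancel = solve-∀

  closedForm-diag : ∀ t → closedForm t t ≡ + a lam k (suc t) - + a lam k t
  closedForm-diag t = trans
    (cong (λ m → + a lam k (suc t) + (+ Λ lam m - + 1) * + a lam k t - + recurrenceSum t m)
          (ℕP.n∸n≡0 t))
    (simplify (+ a lam k (suc t)) (+ a lam k t))
    where
    simplify : ∀ A B → A + (+ 0 - + 1) * B - + 0 ≡ A - B
    simplify = solve-∀

  closedForm-suc : ∀ {j t} → suc t ≤ j →
    closedForm j (suc t) ≡ closedForm j t + (+ Λ lam (j ∸ t) - + 1) * closedForm t t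
  closedForm-suc {j} {t} t<j = begin
    A + (Λᵤ - + 1) * a′ - Σᵤ
      ≡⟨ telescope A Λᵤ l a₀ a′ Σᵤ ⟩
    (A + (Λᵤ + l - + 1) * a₀ - (Σᵤ + l * a′)) + (Λᵤ + l - + 1) * (a′ - a₀)
      ≡⟨ sym (cong₂ (λ x y → x + y * (a′ - a₀)) closedForm-split (cong (_- + 1) Λ-split)) ⟩
    closedForm j t + (+ Λ lam (j ∸ t) - + 1) * (a′ - a₀)
      ≡⟨ cong (λ x → closedForm j t + (+ Λ lam (j ∸ t) - + 1) * x) (sym (closedForm-diag t)) ⟩
    closedForm j t + (+ Λ lam (j ∸ t) - + 1) * closedForm t t
      ∎
    where
    open ≡-Reasoning
    u = j ∸ suc t
    A = + a lam k (suc j)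
    a₀ = + a lam k t
    a′ = + a lam k (suc t)
    Λᵤ = + Λ lam u
    l = + lam (suc u)
    Σᵤ = + recurrenceSum j u
    j∸t≡suc[u] : j ∸ t ≡ suc u
    j∸t≡suc[u] = ∸≡suc[∸suc] t<j
    Λ-split : + Λ lam (j ∸ t) ≡ Λᵤ + l
    Λ-split = trans (cong (λ m → + Λ lam m) j∸t≡suc[u]) (ℤP.pos-+ (Λ lam u) _)
    Σ-split : + recurrenceSum j (j ∸ t) ≡ Σᵤ + l * a′
    Σ-split = begin
      + recurrenceSum j (j ∸ t)
        ≡⟨ cong (λ m → + recurrenceSum j m) j∸t≡suc[u] ⟩
      + (recurrenceSum j u ℕ.+ lam (suc u) ℕ.* a lam k (j ∸ u))
        ≡⟨ cong (λ m → + (recurrenceSum j u ℕ.+ lam (suc u) ℕ.* a lam k m)) (ℕP.m∸[m∸n]≡n t<j) ⟩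
      + (recurrenceSum j u ℕ.+ lam (suc u) ℕ.* a lam k (suc t))
        ≡⟨ trans (ℤP.pos-+ (recurrenceSum j u) _) (cong (_+_ Σᵤ) (ℤP.pos-* (lam (suc u)) _)) ⟩
      Σᵤ + l * a′
        ∎
    closedForm-split : closedForm j t ≡ A + (Λᵤ + l - + 1) * a₀ - (Σᵤ + l * a′)
    closedForm-split = cong₂ (λ x y → A + (x - + 1) * a₀ - y) Λ-split Σ-split
    telescope : ∀ A Λᵤ l a₀ a′ Σᵤ →
      A + (Λᵤ - + 1) * a′ - Σᵤ
        ≡ (A + (Λᵤ + l - + 1) * a₀ - (Σᵤ + l * a′)) + (Λᵤ + l - + 1) * (a′ - a₀)
    telescope = solve-∀

  scaled-leaves≡closedForm : 1 ≤ k → 1 ≤ lam 1 → (∀ i → i > k → lam i ≡ 0) →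
    ∀ {j} t → t ≤ j → + (Λ lam k ∸ 1) * + leaves (Sub lam j t) ≡ closedForm j t
  scaled-leaves≡closedForm k-pos λ₁-pos support {j} zero _ = begin
    + (Λ lam k ∸ 1) * + 1 ≡⟨ ℤP.*-identityʳ _ ⟩
    + (Λ lam k ∸ 1)       ≡⟨ sym (closedForm-zero (Λ-pos lam k-pos λ₁-pos) support j) ⟩
    closedForm j 0        ∎
    where open ≡-Reasoning
  scaled-leaves≡closedForm k-pos λ₁-pos support {j} (suc t) t<j = begin
    c * + leaves (Sub lam j (suc t))
      ≡⟨ cong (c *_) (leaves-Sub-suc lam λ₁-pos t<j) ⟩
    c * (+ leaves (Sub lam j t) + m * + leaves (T lam t))
      ≡⟨ distribute c (+ leaves (Sub lam j t)) m (+ leaves (T lam t)) ⟩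
    c * + leaves (Sub lam j t) + m * (c * + leaves (T lam t))
      ≡⟨ cong₂ (λ x y → x + m * y) (recurse {j} (ℕP.<⇒≤ t<j)) (recurse {t} ℕP.≤-refl) ⟩
    closedForm j t + m * closedForm t t
      ≡⟨ sym (closedForm-suc t<j) ⟩
    closedForm j (suc t)
      ∎
    where
    open ≡-Reasoning
    c = + (Λ lam k ∸ 1)
    m = + Λ lam (j ∸ t) - + 1
    recurse : ∀ {j} → t ≤ j → c * + leaves (Sub lam j t) ≡ closedForm j t
    recurse = scaled-leaves≡closedForm k-pos λ₁-pos support t
    distribute : ∀ c x m y → c * (x + m * y) ≡ c * x + m * (c * y)
    distribute = solve-∀

proposition4p12 : (lam : ℕ → ℕ) (k : ℕ) → 1 ≤ k → 1 ≤ lam 1 → 1 ≤ lam k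
    → (∀ i → i > k → lam i ≡ 0) → (k ≡ 1 → 2 ≤ lam 1)
    → (j t : ℕ) → t ≤ j
    → (+ (Λ lam k ∸ 1)) * (+ L lam j t)
      ≡ (+ a lam k (suc j)) + (+ Λ lam (j ∸ t) - + 1) * (+ a lam k t)
        - (+ Σ₁ (j ∸ t) (λ i → lam i ℕ.* a lam k (suc j ∸ i)))
proposition4p12 lam k k-pos λ₁-pos _ support _ j t t≤j = begin
  + (Λ lam k ∸ 1) * + leaves (special lam j t)
    ≡⟨ cong (λ x → + (Λ lam k ∸ 1) * + leaves x) (special≡Sub lam t≤j) ⟩
  + (Λ lam k ∸ 1) * + leaves (Sub lam j t)
    ≡⟨ scaled-leaves≡closedForm lam k k-pos λ₁-pos support t t≤j ⟩
  closedForm lam k j t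
    ∎
  where open ≡-Reasoning
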